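{- Let $x:\mathbb{R}_D$ be equipped with a locator. Then one can construct $k:\mathbb{Z}$ with $k-1<x<k+1$.
   Context: Work in Martin-Löf type theory with propositional truncation, function extensionality and propositional extensionality. A Dedekind real is a pair $x=(L,U)$ of proposition-valued predicates on $\mathbb{Q}$, writing $q<x$ for $q\in L$ and $x<r$ for $r\in U$, which is bounded, rounded, transitive and located ($q<r\Rightarrow\|(q<x)+(x<r)\|$). $\mathbb{R}_D$ is the type of Dedekind reals. A locator for $x$ is a function $\prod_{q,r:\mathbb{Q}}(q<r)\to(q<x)+(x<r)$ into the untruncated disjoint sum. -}

module Defs where

open import Level using (Level; _⊔_) renaming (suc to lsuc; zero to lzero)
open import Data.Product using (Σ; Σ-syntax; _×_; _,_)
open import Data.Sum using (_⊎_)
open import Data.Rational using (ℚ; _<_; _+_; _-_; 1ℚ; _/_)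
open import Data.Integer using (ℤ)
open import Relation.Binary.PropositionalEquality using (_≡_)

isProp : Set → Set
isProp A = (a b : A) → a ≡ b

-- Propositional truncation, impredicative encoding (as in the HoTT book, sec. 3.7/ex. 3.15)
∥_∥ : Set → Set₁
∥ A ∥ = (P : Set) → isProp P → (A → P) → P

record ℝD : Set₁ where
  field
    L : ℚ → Set
    U : ℚ → Set
    L-prop : ∀ q → isProp (L q)
    U-prop : ∀ r → isProp (U r)
    bounded-L : ∥ Σ ℚ L ∥
    bounded-U : ∥ Σ ℚ U ∥
    rounded-L : ∀ q → (L q → ∥ Σ[ q' ∈ ℚ ] (q < q' × L q') ∥)
                    × (∥ Σ[ q' ∈ ℚ ] (q < q' × L q') ∥ → L q)
    rounded-U : ∀ r → (U r → ∥ Σ[ r' ∈ ℚ ] (r' < r × U r') ∥)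
                    × (∥ Σ[ r' ∈ ℚ ] (r' < r × U r') ∥ → U r)
    transitive : ∀ q r → L q → U r → q < r
    located : ∀ q r → q < r → ∥ L q ⊎ U r ∥

open ℝD public

_<ℝ_ : ℚ → ℝD → Set
q <ℝ x = L x q

_ℝ<_ : ℝD → ℚ → Set
x ℝ< r = U x r

Locator : ℝD → Set
Locator x = ∀ q r → q < r → (q <ℝ x) ⊎ (x ℝ< r)

ℤ→ℚ : ℤ → ℚ
ℤ→ℚ k = k / 1

module Submission where

-- Ask the locator, for every integer k, whether k < x or x < k + 1; write
-- below k for the Boolean answer.  Since the cuts of x are ordered, the answers
-- are descending: once "x < i + 1" has been answered, no j > i is answered
-- "j < x".  Bounds a < x < b give an integer answered "below" and one answered
-- "above", so the sequence has a crossing j (below j true, below (j+1) false),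
-- whence j < x < j + 2 and k = j + 1 works.  The bounds of x are only given
-- under a propositional truncation; this is harmless because a descending
-- Boolean sequence has at most one crossing, so "there is a crossing" is a
-- proposition and may be extracted from the truncation.

open import Defs
open import Data.Product using (Σ; _×_; _,_)
open import Data.Integer using (ℤ)
open import Data.Rational using (_+_; _-_; 1ℚ)

open import Data.Nat using (ℕ; zero; suc; s≤s; z≤n)
open import Data.Bool as Bool using (Bool; true; false)
open import Data.Bool.Properties using (¬-not)
open import Data.Sum using (_⊎_; inj₁; inj₂)
open import Data.Empty using (⊥; ⊥-elim)
open import Relation.Nullary using (yes; no)
open import Axiom.UniquenessOfIdentityProofs using (module Decidable⇒UIP)
import Data.Integer as ℤ
import Data.Integer.Properties as ℤP
import Data.Rational as ℚ
import Data.Rational.Properties as ℚP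
import Data.Rational.Unnormalised as ℚᵘ
import Data.Rational.Unnormalised.Properties as ℚᵘP
open import Relation.Binary.PropositionalEquality

-- Comparisons of normalised rationals can be checked on any unnormalised
-- representatives, where the order is cross-multiplication of integers.
≤-fromᵘ : ∀ {p q p′ q′} → ℚ.toℚᵘ p ℚᵘ.≃ p′ → ℚ.toℚᵘ q ℚᵘ.≃ q′ → p′ ℚᵘ.≤ q′ → p ℚ.≤ q
≤-fromᵘ p≃ q≃ p′≤q′ =
  ℚP.toℚᵘ-cancel-≤ (ℚᵘP.≤-respˡ-≃ (ℚᵘP.≃-sym p≃) (ℚᵘP.≤-respʳ-≃ (ℚᵘP.≃-sym q≃) p′≤q′))

<-fromᵘ : ∀ {p q p′ q′} → ℚ.toℚᵘ p ℚᵘ.≃ p′ → ℚ.toℚᵘ q ℚᵘ.≃ q′ → p′ ℚᵘ.< q′ → p ℚ.< q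
<-fromᵘ p≃ q≃ p′<q′ =
  ℚP.toℚᵘ-cancel-< (ℚᵘP.<-respˡ-≃ (ℚᵘP.≃-sym p≃) (ℚᵘP.<-respʳ-≃ (ℚᵘP.≃-sym q≃) p′<q′))

toℚᵘ-ℤ→ℚ : ∀ k → ℚ.toℚᵘ (ℤ→ℚ k) ℚᵘ.≃ ℚᵘ.mkℚᵘ k 0
toℚᵘ-ℤ→ℚ k = ℚP.toℚᵘ-fromℚᵘ (ℚᵘ.mkℚᵘ k 0)

*1 : ∀ k → k ℤ.* ℤ.1ℤ ≡ k
*1 = ℤP.*-identityʳ

ℤ→ℚ-mono-≤ : ∀ {m n} → m ℤ.≤ n → ℤ→ℚ m ℚ.≤ ℤ→ℚ n
ℤ→ℚ-mono-≤ {m} {n} m≤n = ≤-fromᵘ (toℚᵘ-ℤ→ℚ m) (toℚᵘ-ℤ→ℚ n)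
  (ℚᵘ.*≤* (subst₂ ℤ._≤_ (sym (*1 m)) (sym (*1 n)) m≤n))

ℤ→ℚ-mono-< : ∀ {m n} → m ℤ.< n → ℤ→ℚ m ℚ.< ℤ→ℚ n
ℤ→ℚ-mono-< {m} {n} m<n = <-fromᵘ (toℚᵘ-ℤ→ℚ m) (toℚᵘ-ℤ→ℚ n)
  (ℚᵘ.*<* (subst₂ ℤ._<_ (sym (*1 m)) (sym (*1 n)) m<n))

ℤ→ℚ-suc : ∀ k → ℤ→ℚ (ℤ.suc k) ≡ ℤ→ℚ k + 1ℚ
ℤ→ℚ-suc k = ℚP.toℚᵘ-injective (begin
  ℚ.toℚᵘ (ℤ→ℚ (ℤ.suc k))                    ≈⟨ toℚᵘ-ℤ→ℚ (ℤ.suc k) ⟩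
  ℚᵘ.mkℚᵘ (ℤ.suc k) 0                        ≈⟨ ℚᵘ.*≡* (cong (ℤ._* ℤ.1ℤ) 1+k≡k*1+1) ⟩
  ℚᵘ.mkℚᵘ k 0 ℚᵘ.+ ℚ.toℚᵘ 1ℚ                 ≈⟨ ℚᵘP.+-congˡ (ℚ.toℚᵘ 1ℚ) (ℚᵘP.≃-sym (toℚᵘ-ℤ→ℚ k)) ⟩
  ℚ.toℚᵘ (ℤ→ℚ k) ℚᵘ.+ ℚ.toℚᵘ 1ℚ             ≈⟨ ℚᵘP.≃-sym (ℚP.toℚᵘ-homo-+ (ℤ→ℚ k) 1ℚ) ⟩
  ℚ.toℚᵘ (ℤ→ℚ k + 1ℚ)                       ∎)
  where
  open ℚᵘP.≃-Reasoning
  1+k≡k*1+1 : ℤ.1ℤ ℤ.+ k ≡ k ℤ.* ℤ.1ℤ ℤ.+ ℤ.1ℤ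
  1+k≡k*1+1 = trans (ℤP.+-comm ℤ.1ℤ k) (cong (ℤ._+ ℤ.1ℤ) (sym (*1 k)))

ℤ→ℚ-suc-1 : ∀ k → ℤ→ℚ (ℤ.suc k) - 1ℚ ≡ ℤ→ℚ k
ℤ→ℚ-suc-1 k = begin
  ℤ→ℚ (ℤ.suc k) - 1ℚ        ≡⟨ cong (_- 1ℚ) (ℤ→ℚ-suc k) ⟩
  (ℤ→ℚ k + 1ℚ) - 1ℚ         ≡⟨ ℚP.+-assoc (ℤ→ℚ k) 1ℚ (ℚ.- 1ℚ) ⟩
  ℤ→ℚ k + (1ℚ - 1ℚ)         ≡⟨ cong (ℤ→ℚ k +_) (ℚP.+-inverseʳ 1ℚ) ⟩
  ℤ→ℚ k + ℚ.0ℚ              ≡⟨ ℚP.+-identityʳ (ℤ→ℚ k) ⟩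
  ℤ→ℚ k                     ∎
  where open ≡-Reasoning

-- Archimedean property: every rational lies between two integers.  Both bounds
-- are checked on the fraction n/(d+1) representing the rational, using 1 ≤ d+1.
1≤suc : ∀ d → ℤ.1ℤ ℤ.≤ ℤ.+ suc d
1≤suc d = ℤ.+≤+ (s≤s z≤n)

ℤ-above : ∀ r → Σ ℤ (λ k → r ℚ.≤ ℤ→ℚ k)
ℤ-above (ℚ.mkℚ n@(ℤ.+ _) d _) =
  n , ≤-fromᵘ ℚᵘP.≃-refl (toℚᵘ-ℤ→ℚ n) (ℚᵘ.*≤* (ℤP.*-monoˡ-≤-nonNeg n (1≤suc d)))
ℤ-above (ℚ.mkℚ ℤ.-[1+ _ ] _ _) =
  ℤ.0ℤ , ≤-fromᵘ ℚᵘP.≃-refl (toℚᵘ-ℤ→ℚ ℤ.0ℤ) (ℚᵘ.*≤* ℤ.-≤+)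

ℤ-below : ∀ r → Σ ℤ (λ k → ℤ→ℚ k ℚ.≤ r)
ℤ-below (ℚ.mkℚ n@(ℤ.+ _) _ _) =
  ℤ.0ℤ , ≤-fromᵘ (toℚᵘ-ℤ→ℚ ℤ.0ℤ) ℚᵘP.≃-refl (ℚᵘ.*≤* (subst (ℤ.0ℤ ℤ.≤_) (sym (*1 n)) (ℤ.+≤+ z≤n)))
ℤ-below (ℚ.mkℚ n@(ℤ.-[1+ _ ]) d _) =
  n , ≤-fromᵘ (toℚᵘ-ℤ→ℚ n) ℚᵘP.≃-refl (ℚᵘ.*≤* (ℤP.*-monoˡ-≤-nonPos n (1≤suc d)))

true≢false : true ≡ false → ⊥
true≢false ()

Crossing : (ℤ → Bool) → ℤ → Set
Crossing f j = f j ≡ true × f (ℤ.suc j) ≡ false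

Descending : (ℤ → Bool) → Set
Descending f = ∀ {i j} → i ℤ.≤ j → f i ≡ false → f j ≡ false

crossing-within : (f : ℤ → Bool) (n : ℕ) {m : ℤ} →
                  f m ≡ true → f (ℤ.+ n ℤ.+ m) ≡ false → Σ ℤ (Crossing f)
crossing-within f zero {m} fm fn =
  ⊥-elim (true≢false (trans (sym fm) (subst (λ i → f i ≡ false) (ℤP.+-identityˡ m) fn)))
crossing-within f (suc n) {m} fm fsn with f (ℤ.+ n ℤ.+ m) in fn
... | true  = ℤ.+ n ℤ.+ m , fn , subst (λ i → f i ≡ false) (ℤP.suc-+ n m) fsn
... | false = crossing-within f n fm fn

i≤+∣i∣ : ∀ i → i ℤ.≤ ℤ.+ ℤ.∣ i ∣
i≤+∣i∣ (ℤ.+ _)    = ℤP.≤-refl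
i≤+∣i∣ ℤ.-[1+ _ ] = ℤ.-≤+

crossing-exists : (f : ℤ → Bool) → Descending f →
                  Σ ℤ (λ m → f m ≡ true) → Σ ℤ (λ M → f M ≡ false) → Σ ℤ (Crossing f)
crossing-exists f descending (m , fm) (M , fM) =
  crossing-within f ℤ.∣ M ℤ.- m ∣ fm (descending M≤ fM)
  where
  open ℤP.≤-Reasoning
  M≤ : M ℤ.≤ ℤ.+ ℤ.∣ M ℤ.- m ∣ ℤ.+ m
  M≤ = begin
    M                        ≡⟨ ℤP.+-identityʳ M ⟨
    M ℤ.+ ℤ.0ℤ               ≡⟨ cong (λ i → M ℤ.+ i) (ℤP.+-inverseˡ m) ⟨
    M ℤ.+ (ℤ.- m ℤ.+ m)      ≡⟨ ℤP.+-assoc M (ℤ.- m) m ⟨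
    (M ℤ.- m) ℤ.+ m          ≤⟨ ℤP.+-monoˡ-≤ m (i≤+∣i∣ (M ℤ.- m)) ⟩
    ℤ.+ ℤ.∣ M ℤ.- m ∣ ℤ.+ m  ∎

true-below-crossing : {f : ℤ → Bool} → Descending f →
                      ∀ {i j} → Crossing f j → f i ≡ true → i ℤ.≤ j
true-below-crossing descending (_ , fsj) fi = ℤP.≮⇒≥ λ j<i →
  true≢false (trans (sym fi) (descending (ℤP.i<j⇒suc[i]≤j j<i) fsj))

crossing-unique : (f : ℤ → Bool) → Descending f → isProp (Σ ℤ (Crossing f))
crossing-unique f descending (j , c@(fj , _)) (j′ , c′@(fj′ , _))
  with ℤP.≤-antisym (true-below-crossing descending c′ fj) (true-below-crossing descending c fj′)
... | refl = cong (j ,_) (cong₂ _,_ (≡-irrelevant _ _) (≡-irrelevant _ _))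
  where open Decidable⇒UIP Bool._≟_ using (≡-irrelevant)

cuts-ordered : (x : ℝD) → ∀ {p q} → p <ℝ x → x ℝ< q → q ℚ.≤ p → ⊥
cuts-ordered x {p} {q} p<x x<q q≤p = ℚP.<-irrefl refl (ℚP.<-≤-trans (transitive x p q p<x x<q) q≤p)

isLeft : {A B : Set} → A ⊎ B → Bool
isLeft (inj₁ _) = true
isLeft (inj₂ _) = false

fromLeft : {A B : Set} (s : A ⊎ B) → isLeft s ≡ true → A
fromLeft (inj₁ a) _ = a

fromRight : {A B : Set} (s : A ⊎ B) → isLeft s ≡ false → B
fromRight (inj₂ b) _ = b

module Scan (x : ℝD) (locator : Locator x) where

  probe : (k : ℤ) → (ℤ→ℚ k <ℝ x) ⊎ (x ℝ< ℤ→ℚ (ℤ.suc k))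
  probe k = locator (ℤ→ℚ k) (ℤ→ℚ (ℤ.suc k)) (ℤ→ℚ-mono-< {k} (ℤP.suc[i]≤j⇒i<j ℤP.≤-refl))

  below : ℤ → Bool
  below k = isLeft (probe k)

  below-true : ∀ k → below k ≡ true → ℤ→ℚ k <ℝ x
  below-true k = fromLeft (probe k)

  below-false : ∀ k → below k ≡ false → x ℝ< ℤ→ℚ (ℤ.suc k)
  below-false k = fromRight (probe k)

  -- If x < i+1 ≤ j, the locator cannot have answered j < x.
  below-strict : ∀ {i j} → i ℤ.< j → below i ≡ false → below j ≡ false
  below-strict {i} {j} i<j fi = ¬-not λ fj →
    cuts-ordered x (below-true j fj) (below-false i fi) (ℤ→ℚ-mono-≤ (ℤP.i<j⇒suc[i]≤j i<j))

  below-descending : Descending below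
  below-descending {i} {j} i≤j fi with i ℤ.≟ j
  ... | yes refl = fi
  ... | no i≢j   = below-strict (ℤP.≤∧≢⇒< i≤j i≢j) fi

  below-somewhere : ∀ {a} → a <ℝ x → Σ ℤ (λ m → below m ≡ true)
  below-somewhere {a} a<x with ℤ-below a
  ... | m , m≤a = ℤ.pred m , ¬-not λ fm →
    cuts-ordered x a<x (subst (λ k → x ℝ< ℤ→ℚ k) (ℤP.suc-pred m) (below-false (ℤ.pred m) fm)) m≤a

  above-somewhere : ∀ {b} → x ℝ< b → Σ ℤ (λ M → below M ≡ false)
  above-somewhere {b} x<b with ℤ-above b
  ... | M , b≤M = M , ¬-not λ tM → cuts-ordered x (below-true M tM) x<b b≤M

  -- The answers cross exactly once; uniqueness makes the crossing a proposition,
  -- so it can be extracted from the truncated bounds of x.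
  the-crossing : Σ ℤ (Crossing below)
  the-crossing =
    bounded-L x _ crossing-prop λ (a , a<x) →
    bounded-U x _ crossing-prop λ (b , x<b) →
    crossing-exists below below-descending (below-somewhere a<x) (above-somewhere x<b)
    where
    crossing-prop : isProp (Σ ℤ (Crossing below))
    crossing-prop = crossing-unique below below-descending

  -- At a crossing j we have j < x < j + 2, so k = j + 1 is the required integer.
  crossing-bounds : ∀ j → Crossing below j →
                    ((ℤ→ℚ (ℤ.suc j) - 1ℚ) <ℝ x) × (x ℝ< (ℤ→ℚ (ℤ.suc j) + 1ℚ))
  crossing-bounds j (tj , fsj) =
    subst (λ q → q <ℝ x) (sym (ℤ→ℚ-suc-1 j)) (below-true j tj) ,
    subst (λ q → x ℝ< q) (ℤ→ℚ-suc (ℤ.suc j)) (below-false (ℤ.suc j) fsj)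

lemma3p35 : (x : ℝD) → Locator x →
    Σ ℤ (λ k → ((ℤ→ℚ k - 1ℚ) <ℝ x) × (x ℝ< (ℤ→ℚ k + 1ℚ)))
lemma3p35 x locator with Scan.the-crossing x locator
... | j , crossing = ℤ.suc j , Scan.crossing-bounds x locator j crossing
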